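{- The class of odd 4-multipedes is finitely axiomatizable, i.e., it is the class of all finite models of a single first-order sentence in the vocabulary $\{E,T,<,\in\}$.
   Context: All structures are finite. A 2-multipede is a structure $(U_0,E,T)$ where: $(U_0,E)$ is a directed graph with $D(E)\cap R(E)=\emptyset$, $D(E)\cup R(E)=U_0$ ($D(E)$ = domain, $R(E)$ = range of $E$), each element of $D(E)$ (a foot) has exactly one outgoing edge, each element of $R(E)$ (a segment) has exactly two incoming edges; $S(a)$ denotes the segment of a foot $a$ and $S(y)=y$ for segments; $T$ is a set of 3-element subsets (hyperedges) each consisting entirely of segments or entirely of feet, with $S(h)\in T$ for every foot hyperedge $h$; and for each segment hyperedge $X$, among the 3-element foot sets $A$ with $S(A)=X$ (slaves; positive if $A\in T$) exactly four are positive and they are pairwise equivalent, two slaves being equivalent if equal or one is obtained from the other by swapping the feet of exactly two segments. A 3-multipede is a 2-multipede together with a linear order $<$ on the set of segments. A 4-multipede is a structure $(U,E,T,<,\in)$ whose universe is the disjoint union of $U_0$ and a set $\Sigma$ of super-segments, where $(U_0,E,T,<)$ is a 3-multipede, $E,T,<$ involve only elements of $U_0$, $\in$ is a relation between segments and super-segments, and the map $\sigma\mapsto\{x: x\in\sigma\}$ is a bijection from $\Sigma$ onto the set of all sets of segments. A 4-multipede is odd if its segment hypergraph (segments with the hyperedges of $T$ consisting of segments) is odd: for every nonempty set $X$ of segments some segment hyperedge $h$ has $|h\cap X|$ odd. -}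

module Defs where

open import Data.Nat using (ℕ; zero; suc; _+_; _%_)
open import Data.Fin using (Fin)
open import Data.Fin.Subset using (Subset; _∈_; _∉_)
open import Data.Fin.Subset.Properties using (_∈?_)
open import Data.Vec using (Vec; lookup; _∷_)
open import Data.Bool using (Bool; true; false)
open import Data.Product using (Σ; ∃; _×_; _,_)
open import Data.Sum using (_⊎_)
open import Relation.Binary.PropositionalEquality using (_≡_; _≢_)
open import Relation.Nullary using (¬_; does)
open import Function.Bundles using (_⇔_)

-- The universe is Fin size; every finite
-- structure is isomorphic to one of these.  A 3-element set {x,y,z} of
-- the paper is in T iff the ternary relation T holds of x,y,z (the
-- multipede axioms below force T to be symmetric and to hold only of
-- pairwise distinct elements).

record Structure : Set where
  field
    size : ℕ
    E    : Fin size → Fin size → Bool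
    T    : Fin size → Fin size → Fin size → Bool
    Lt   : Fin size → Fin size → Bool
    In   : Fin size → Fin size → Bool

data Formula (k : ℕ) : Set where
  _≐_  : Fin k → Fin k → Formula k
  rE   : Fin k → Fin k → Formula k
  rT   : Fin k → Fin k → Fin k → Formula k
  rLt  : Fin k → Fin k → Formula k
  rIn  : Fin k → Fin k → Formula k
  ¬'_  : Formula k → Formula k
  _∧'_ : Formula k → Formula k → Formula k
  ∃'_  : Formula (suc k) → Formula k

Sentence : Set
Sentence = Formula 0

module _ (A : Structure) where
  open Structure A

  Sat : ∀ {k} → Formula k → Vec (Fin size) k → Set
  Sat (x ≐ y)     ρ = lookup ρ x ≡ lookup ρ y
  Sat (rE x y)    ρ = E (lookup ρ x) (lookup ρ y) ≡ true
  Sat (rT x y z)  ρ = T (lookup ρ x) (lookup ρ y) (lookup ρ z) ≡ true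
  Sat (rLt x y)   ρ = Lt (lookup ρ x) (lookup ρ y) ≡ true
  Sat (rIn x y)   ρ = In (lookup ρ x) (lookup ρ y) ≡ true
  Sat (¬' φ)      ρ = ¬ Sat φ ρ
  Sat (φ ∧' ψ)    ρ = Sat φ ρ × Sat ψ ρ
  Sat (∃' φ)      ρ = Σ (Fin size) λ a → Sat φ (a ∷ ρ)

_⊨_ : Structure → Sentence → Set
A ⊨ φ = Sat A φ Data.Vec.[]

module _ (A : Structure) where
  open Structure A

  private
    U : Set
    U = Fin size

  Foot : U → Set
  Foot a = ∃ λ y → E a y ≡ true

  Seg : U → Set
  Seg y = ∃ λ a → E a y ≡ true

  InU₀ : U → Set
  InU₀ x = Foot x ⊎ Seg x

  SuperSeg : U → Set
  SuperSeg x = ¬ InU₀ x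

  -- a slave of the segment hyperedge {x,y,z}: a foot set {a,b,c}
  -- with S(a)=x, S(b)=y, S(c)=z (represented by the triple (a,b,c))
  IsSlave : U → U → U → U × U × U → Set
  IsSlave x y z (a , b , c) = E a x ≡ true × E b y ≡ true × E c z ≡ true

  Positive : U × U × U → Set
  Positive (a , b , c) = T a b c ≡ true

  -- equivalence of slaves: equal, or the feet of exactly two of the
  -- three segments are swapped
  SlaveEquiv : U × U × U → U × U × U → Set
  SlaveEquiv (a , b , c) (a' , b' , c') =
    ((a , b , c) ≡ (a' , b' , c'))
    ⊎ (a ≢ a' × b ≢ b' × c ≡ c')
    ⊎ (a ≢ a' × b ≡ b' × c ≢ c')
    ⊎ (a ≡ a' × b ≢ b' × c ≢ c')

  record Is2Multipede : Set where
    field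
      feet-not-segments : ∀ x → ¬ (Foot x × Seg x)
      foot-one-edge     : ∀ a y y' → E a y ≡ true → E a y' ≡ true → y ≡ y'
      segment-two-feet  : ∀ y → Seg y →
        Σ U λ a → Σ U λ b → a ≢ b × E a y ≡ true × E b y ≡ true ×
          (∀ c → E c y ≡ true → c ≡ a ⊎ c ≡ b)
      T-distinct : ∀ x y z → T x y z ≡ true → x ≢ y × y ≢ z × x ≢ z
      T-sym₁     : ∀ x y z → T x y z ≡ true → T y x z ≡ true
      T-sym₂     : ∀ x y z → T x y z ≡ true → T x z y ≡ true
      T-sorted   : ∀ x y z → T x y z ≡ true →
        (Seg x × Seg y × Seg z) ⊎ (Foot x × Foot y × Foot z)
      T-shadow   : ∀ a b c x y z → T a b c ≡ true →
        Foot a → Foot b → Foot c →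
        E a x ≡ true → E b y ≡ true → E c z ≡ true → T x y z ≡ true
      T-slaves   : ∀ x y z → T x y z ≡ true → Seg x → Seg y → Seg z →
        Σ (U × U × U) λ s₁ → Σ (U × U × U) λ s₂ →
        Σ (U × U × U) λ s₃ → Σ (U × U × U) λ s₄ →
          (IsSlave x y z s₁ × IsSlave x y z s₂ ×
           IsSlave x y z s₃ × IsSlave x y z s₄) ×
          (Positive s₁ × Positive s₂ × Positive s₃ × Positive s₄) ×
          (s₁ ≢ s₂ × s₁ ≢ s₃ × s₁ ≢ s₄ × s₂ ≢ s₃ × s₂ ≢ s₄ × s₃ ≢ s₄) ×
          (SlaveEquiv s₁ s₂ × SlaveEquiv s₁ s₃ × SlaveEquiv s₁ s₄ ×
           SlaveEquiv s₂ s₃ × SlaveEquiv s₂ s₄ × SlaveEquiv s₃ s₄) ×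
          (∀ s → IsSlave x y z s → Positive s →
             s ≡ s₁ ⊎ s ≡ s₂ ⊎ s ≡ s₃ ⊎ s ≡ s₄)

  record Is3Multipede : Set where
    field
      is2         : Is2Multipede
      Lt-segments : ∀ x y → Lt x y ≡ true → Seg x × Seg y
      Lt-irrefl   : ∀ x → ¬ (Lt x x ≡ true)
      Lt-trans    : ∀ x y z → Lt x y ≡ true → Lt y z ≡ true → Lt x z ≡ true
      Lt-total    : ∀ x y → Seg x → Seg y → Lt x y ≡ true ⊎ x ≡ y ⊎ Lt y x ≡ true

  record Is4Multipede : Set where
    field
      is3 : Is3Multipede
      -- (E, T, < involve only elements of U₀: ensured by the definition
      --  of U₀ and the axioms T-sorted, Lt-segments)
      In-sorted : ∀ x σ → In x σ ≡ true → Seg x × SuperSeg σ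
      In-injective : ∀ σ τ → SuperSeg σ → SuperSeg τ →
        (∀ x → In x σ ≡ true ⇔ In x τ ≡ true) → σ ≡ τ
      In-surjective : ∀ (X : Subset size) → (∀ x → x ∈ X → Seg x) →
        Σ U λ σ → SuperSeg σ × (∀ x → In x σ ≡ true ⇔ x ∈ X)

  count∈ : Subset size → U → U → U → ℕ
  count∈ X x y z = b2n (does (x ∈? X)) + b2n (does (y ∈? X)) + b2n (does (z ∈? X))
    where
    b2n : Bool → ℕ
    b2n true  = 1
    b2n false = 0

  IsOdd : Set
  IsOdd = ∀ (X : Subset size) → (∀ x → x ∈ X → Seg x) → (∃ λ x → x ∈ X) →
    Σ U λ x → Σ U λ y → Σ U λ z →
      T x y z ≡ true × Seg x × Seg y × Seg z × count∈ X x y z % 2 ≡ 1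

  IsOdd4Multipede : Set
  IsOdd4Multipede = Is4Multipede × IsOdd

FinitelyAxiomatizable : (Structure → Set) → Set
FinitelyAxiomatizable K = Σ Sentence λ φ → ∀ (A : Structure) → (A ⊨ φ) ⇔ K A

module Submission where

-- Every clause in the definition of an odd 4-multipede is first order except the two that
-- quantify over sets of segments: surjectivity of σ ↦ {x : x ∈ σ}, and oddness. In a finite
-- structure surjectivity is equivalent to two first-order clauses, namely that the empty set
-- is represented and that adding one segment to a represented set gives a represented set,
-- because every finite set arises from ∅ by finitely many insertions. Once every set of
-- segments is represented by a super-segment, oddness may quantify over super-segments σ
-- instead, and |h ∩ X| is odd exactly when an odd number of the three elements of h are ∈ σ,
-- a Boolean combination of atomic formulas. Satisfaction in a finite structure is decidable,
-- so the connectives ∨, ⇒, ∀ defined through ¬ have their classical meaning.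

open import Defs
import Data.Nat as ℕ
open import Data.Nat using (_%_)
open import Data.Bool using (Bool; true; false; not; _xor_) renaming (_∧_ to _and_)
open import Data.Bool.Properties using (T-≡)
open import Data.Fin using (Fin; zero; suc; #_; _≟_; _↑ʳ_)
open import Data.Fin.Properties using (any?)
open import Data.Fin.Subset using (Subset; _∈_; _∪_; ⁅_⁆) renaming (⊥ to ∅)
open import Data.Fin.Subset.Properties using (_∈?_; ∉⊥; ∪⇔⊎; x∈⁅y⁆⇔x≡y)
open import Data.Vec using (Vec; []; _∷_; lookup; tabulate)
open import Data.Vec.Properties using (lookup∘tabulate; lookup⇒[]=; []=⇒lookup)
open import Data.List using (List; []; _∷_; filter; allFin)
open import Data.List.Membership.Propositional using () renaming (_∈_ to _∈ₗ_)
open import Data.List.Membership.Propositional.Properties using (∈-filter⁺; ∈-filter⁻; ∈-allFin)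
open import Data.List.Relation.Unary.Any using (here; there)
open import Data.List.Relation.Unary.Any.Properties using (∷↔)
open import Data.Product using (Σ; _×_; _,_; proj₁; proj₂; map₂)
open import Data.Sum using (_⊎_; inj₁; inj₂)
import Data.Sum as Sum
open import Data.Sum.Function.Propositional using (_⊎-⇔_)
open import Data.Empty using (⊥-elim)
open import Function using (_∘_)
open import Relation.Nullary using (¬_; Dec; yes; no; does; ¬?; _×-dec_)
open import Relation.Nullary.Decidable using (decidable-stable; dec-true; does-⇔; map; T?)
open import Relation.Binary.PropositionalEquality using (_≡_; _≢_; refl; sym; trans; cong; cong₂; subst; module ≡-Reasoning)
open import Function.Bundles using (_⇔_; mk⇔; Equivalence)
open import Function.Properties.Equivalence using () renaming (refl to ⇔-refl; sym to ⇔-sym; trans to ⇔-trans)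
open import Function.Properties.Inverse using (↔⇒⇔)

open Equivalence using (to; from)

infixr 5 _⊕_
infixr 4 _∧_
infixr 3 _∨_
infixr 2 _⇒_
infix 2 _↔_

_∧_ : ∀ {k} → Formula k → Formula k → Formula k
φ ∧ ψ = φ ∧' ψ

-- The derived connectives are opaque so that Sat cannot unfold them: formulas stay visible in
-- types, which lets Agda infer the implicit arguments of their introduction and elimination
-- lemmas.
opaque
  _∨_ : ∀ {k} → Formula k → Formula k → Formula k
  φ ∨ ψ = ¬' ((¬' φ) ∧' (¬' ψ))

opaque
  _⇒_ : ∀ {k} → Formula k → Formula k → Formula k
  φ ⇒ ψ = ¬' (φ ∧' (¬' ψ))

opaque
  ∀'_ : ∀ {k} → Formula (ℕ.suc k) → Formula k
  ∀' φ = ¬' (∃' (¬' φ))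

opaque
  _⊕_ : ∀ {k} → Formula k → Formula k → Formula k
  φ ⊕ ψ = (¬' (φ ∧' ψ)) ∧' (¬' ((¬' φ) ∧' (¬' ψ)))

_↔_ : ∀ {k} → Formula k → Formula k → Formula k
φ ↔ ψ = (φ ⇒ ψ) ∧ (ψ ⇒ φ)

∃₃_ ∀₃_ : ∀ {k} → Formula (3 ℕ.+ k) → Formula k
∃₃ φ = ∃' (∃' (∃' φ))
∀₃ φ = ∀' (∀' (∀' φ))

-- Decided through T?, so that does (isTrue? b) is b by definition.
isTrue? : (b : Bool) → Dec (b ≡ true)
isTrue? b = map T-≡ (T? b)

xor-as-¬∧ : ∀ a b → not (a and b) and not (not a and not b) ≡ a xor b
xor-as-¬∧ true  true  = refl
xor-as-¬∧ true  false = refl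
xor-as-¬∧ false true  = refl
xor-as-¬∧ false false = refl

≡×≡×≡⇔≡ : ∀ {X : Set} {a b c a' b' c' : X} →
  (a ≡ a' × b ≡ b' × c ≡ c') ⇔ ((a , b , c) ≡ (a' , b' , c'))
≡×≡×≡⇔≡ = mk⇔ (λ { (refl , refl , refl) → refl }) (λ { refl → refl , refl , refl })

module Semantics (A : Structure) where
  open Structure A

  sat? : ∀ {k} (φ : Formula k) (ρ : Vec (Fin size) k) → Dec (Sat A φ ρ)
  sat? (x ≐ y)    ρ = lookup ρ x ≟ lookup ρ y
  sat? (rE x y)   ρ = isTrue? (E (lookup ρ x) (lookup ρ y))
  sat? (rT x y z) ρ = isTrue? (T (lookup ρ x) (lookup ρ y) (lookup ρ z))
  sat? (rLt x y)  ρ = isTrue? (Lt (lookup ρ x) (lookup ρ y))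
  sat? (rIn x y)  ρ = isTrue? (In (lookup ρ x) (lookup ρ y))
  sat? (¬' φ)     ρ = ¬? (sat? φ ρ)
  sat? (φ ∧' ψ)   ρ = sat? φ ρ ×-dec sat? ψ ρ
  sat? (∃' φ)     ρ = any? λ a → sat? φ (a ∷ ρ)

  truth : ∀ {k} → Formula k → Vec (Fin size) k → Bool
  truth φ ρ = does (sat? φ ρ)

  private variable
    k : ℕ.ℕ
    ρ : Vec (Fin size) k

  ¬¬-elim : ∀ {φ} → ¬ ¬ Sat A φ ρ → Sat A φ ρ
  ¬¬-elim {ρ = ρ} {φ} = decidable-stable (sat? φ ρ)

  sat⇔truth : ∀ φ → Sat A φ ρ ⇔ truth φ ρ ≡ true
  sat⇔truth {ρ = ρ} φ = mk⇔ (dec-true (sat? φ ρ)) (witness (sat? φ ρ))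
    where
    witness : ∀ {P} (P? : Dec P) → does P? ≡ true → P
    witness (yes p) _ = p

  opaque
    unfolding _∨_

    ∨⇔ : ∀ {φ ψ} → Sat A (φ ∨ ψ) ρ ⇔ (Sat A φ ρ ⊎ Sat A ψ ρ)
    ∨⇔ {ρ = ρ} {φ} = mk⇔ elim (λ p (¬p , ¬q) → Sum.[ ¬p , ¬q ] p)
      where
      elim : ∀ {ψ} → Sat A (φ ∨ ψ) ρ → Sat A φ ρ ⊎ Sat A ψ ρ
      elim h with sat? φ ρ
      ... | yes p = inj₁ p
      ... | no ¬p = inj₂ (¬¬-elim λ ¬q → h (¬p , ¬q))

  opaque
    unfolding _⇒_

    ⇒-intro : ∀ {φ ψ} → (Sat A φ ρ → Sat A ψ ρ) → Sat A (φ ⇒ ψ) ρ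
    ⇒-intro f (p , ¬q) = ¬q (f p)

    infixl 1 _$⇒_
    _$⇒_ : ∀ {φ ψ} → Sat A (φ ⇒ ψ) ρ → Sat A φ ρ → Sat A ψ ρ
    h $⇒ p = ¬¬-elim λ ¬q → h (p , ¬q)

  opaque
    unfolding ∀'_

    ∀-intro : ∀ {φ} → (∀ a → Sat A φ (a ∷ ρ)) → Sat A (∀' φ) ρ
    ∀-intro f (a , ¬p) = ¬p (f a)

    infixl 1 _$∀_
    _$∀_ : ∀ {φ} → Sat A (∀' φ) ρ → ∀ a → Sat A φ (a ∷ ρ)
    h $∀ a = ¬¬-elim λ ¬p → h (a , ¬p)

  ∀₃-intro : ∀ {φ} → (∀ a b c → Sat A φ (c ∷ b ∷ a ∷ ρ)) → Sat A (∀₃ φ) ρ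
  ∀₃-intro f = ∀-intro λ a → ∀-intro λ b → ∀-intro λ c → f a b c

  opaque
    unfolding _⊕_

    truth-⊕ : ∀ φ ψ → truth (φ ⊕ ψ) ρ ≡ truth φ ρ xor truth ψ ρ
    truth-⊕ {ρ = ρ} φ ψ = xor-as-¬∧ (truth φ ρ) (truth ψ ρ)

  ↔⇔ : ∀ {φ ψ} → Sat A (φ ↔ ψ) ρ ⇔ (Sat A φ ρ ⇔ Sat A ψ ρ)
  ↔⇔ = mk⇔ (λ (f , g) → mk⇔ (f $⇒_) (g $⇒_)) (λ e → ⇒-intro (to e) , ⇒-intro (from e))

foot segment superSegment : ∀ {k} → Fin k → Formula k
foot x = ∃' rE (suc x) zero
segment x = ∃' rE zero (suc x)
superSegment x = ¬' (foot x ∨ segment x)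

Triple : ℕ.ℕ → Set
Triple k = Fin k × Fin k × Fin k

isSlaveᶠ : ∀ {k} → Fin k → Fin k → Fin k → Triple k → Formula k
isSlaveᶠ x y z (a , b , c) = rE a x ∧ rE b y ∧ rE c z

positiveᶠ : ∀ {k} → Triple k → Formula k
positiveᶠ (a , b , c) = rT a b c

opaque
  _≐₃_ : ∀ {k} → Triple k → Triple k → Formula k
  (a , b , c) ≐₃ (a' , b' , c') = (a ≐ a') ∧ (b ≐ b') ∧ (c ≐ c')

opaque
  slaveEquivᶠ : ∀ {k} → Triple k → Triple k → Formula k
  slaveEquivᶠ s@(a , b , c) s'@(a' , b' , c') =
    s ≐₃ s'
    ∨ (¬' (a ≐ a')) ∧ (¬' (b ≐ b')) ∧ (c ≐ c')
    ∨ (¬' (a ≐ a')) ∧ (b ≐ b') ∧ (¬' (c ≐ c'))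
    ∨ (a ≐ a') ∧ (¬' (b ≐ b')) ∧ (¬' (c ≐ c'))

fourPositiveSlavesᶠ : ∀ {k} → Fin k → Fin k → Fin k → (s₁ s₂ s₃ s₄ : Triple k) → Formula k
fourPositiveSlavesᶠ {k} x y z s₁ s₂ s₃ s₄ =
  (isSlaveᶠ x y z s₁ ∧ isSlaveᶠ x y z s₂ ∧ isSlaveᶠ x y z s₃ ∧ isSlaveᶠ x y z s₄) ∧
  (positiveᶠ s₁ ∧ positiveᶠ s₂ ∧ positiveᶠ s₃ ∧ positiveᶠ s₄) ∧
  ((¬' (s₁ ≐₃ s₂)) ∧ (¬' (s₁ ≐₃ s₃)) ∧ (¬' (s₁ ≐₃ s₄)) ∧
   (¬' (s₂ ≐₃ s₃)) ∧ (¬' (s₂ ≐₃ s₄)) ∧ (¬' (s₃ ≐₃ s₄))) ∧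
  (slaveEquivᶠ s₁ s₂ ∧ slaveEquivᶠ s₁ s₃ ∧ slaveEquivᶠ s₁ s₄ ∧
   slaveEquivᶠ s₂ s₃ ∧ slaveEquivᶠ s₂ s₄ ∧ slaveEquivᶠ s₃ s₄) ∧
  ∀₃ (isSlaveᶠ (↑ x) (↑ y) (↑ z) new ⇒ positiveᶠ new ⇒
      new ≐₃ ↑₃ s₁ ∨ new ≐₃ ↑₃ s₂ ∨ new ≐₃ ↑₃ s₃ ∨ new ≐₃ ↑₃ s₄)
  where
  ↑ : Fin k → Fin (3 ℕ.+ k)
  ↑ = 3 ↑ʳ_
  ↑₃ : Triple k → Triple (3 ℕ.+ k)
  ↑₃ (a , b , c) = ↑ a , ↑ b , ↑ c
  new : Triple (3 ℕ.+ k)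
  new = # 2 , # 1 , # 0

-- Below the twelve quantified feet the segments x, y, z are the variables # 14, # 13, # 12.
hasFourPositiveSlaves : Formula 3
hasFourPositiveSlaves = ∃₃ (∃₃ (∃₃ (∃₃ (fourPositiveSlavesᶠ (# 14) (# 13) (# 12)
  (# 11 , # 10 , # 9) (# 8 , # 7 , # 6) (# 5 , # 4 , # 3) (# 2 , # 1 , # 0)))))

Multipede₂ : Sentence
Multipede₂ =
  feet-not-segments ∧ foot-one-edge ∧ segment-two-feet ∧ T-distinct ∧ T-sym₁ ∧ T-sym₂ ∧
  T-sorted ∧ T-shadow ∧ T-slaves
  where
  feet-not-segments foot-one-edge segment-two-feet T-distinct T-sym₁ T-sym₂ T-sorted
    T-shadow T-slaves : Sentence
  feet-not-segments = ∀' (¬' (foot (# 0) ∧ segment (# 0)))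
  foot-one-edge = ∀₃ (rE (# 2) (# 1) ∧ rE (# 2) (# 0) ⇒ (# 1) ≐ (# 0))
  segment-two-feet = ∀' (segment (# 0) ⇒ ∃' (∃' (
    (¬' ((# 1) ≐ (# 0))) ∧ rE (# 1) (# 2) ∧ rE (# 0) (# 2) ∧
    ∀' (rE (# 0) (# 3) ⇒ (# 0) ≐ (# 2) ∨ (# 0) ≐ (# 1)))))
  T-distinct = ∀₃ (rT (# 2) (# 1) (# 0) ⇒
    (¬' ((# 2) ≐ (# 1))) ∧ (¬' ((# 1) ≐ (# 0))) ∧ (¬' ((# 2) ≐ (# 0))))
  T-sym₁ = ∀₃ (rT (# 2) (# 1) (# 0) ⇒ rT (# 1) (# 2) (# 0))
  T-sym₂ = ∀₃ (rT (# 2) (# 1) (# 0) ⇒ rT (# 2) (# 0) (# 1))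
  T-sorted = ∀₃ (rT (# 2) (# 1) (# 0) ⇒
    (segment (# 2) ∧ segment (# 1) ∧ segment (# 0)) ∨ (foot (# 2) ∧ foot (# 1) ∧ foot (# 0)))
  T-shadow = ∀₃ (∀₃ (rT (# 5) (# 4) (# 3) ⇒ foot (# 5) ⇒ foot (# 4) ⇒ foot (# 3) ⇒
    rE (# 5) (# 2) ⇒ rE (# 4) (# 1) ⇒ rE (# 3) (# 0) ⇒ rT (# 2) (# 1) (# 0)))
  T-slaves = ∀₃ (rT (# 2) (# 1) (# 0) ⇒ segment (# 2) ⇒ segment (# 1) ⇒ segment (# 0) ⇒
    hasFourPositiveSlaves)

Multipede₃ : Sentence
Multipede₃ = Multipede₂ ∧ Lt-segments ∧ Lt-irrefl ∧ Lt-trans ∧ Lt-total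
  where
  Lt-segments Lt-irrefl Lt-trans Lt-total : Sentence
  Lt-segments = ∀' (∀' (rLt (# 1) (# 0) ⇒ segment (# 1) ∧ segment (# 0)))
  Lt-irrefl = ∀' (¬' (rLt (# 0) (# 0)))
  Lt-trans = ∀₃ (rLt (# 2) (# 1) ⇒ rLt (# 1) (# 0) ⇒ rLt (# 2) (# 0))
  Lt-total = ∀' (∀' (segment (# 1) ⇒ segment (# 0) ⇒
    rLt (# 1) (# 0) ∨ (# 1) ≐ (# 0) ∨ rLt (# 0) (# 1)))

membersSatisfy : ∀ {k} → Formula (2 ℕ.+ k) → Formula (1 ℕ.+ k)
membersSatisfy ψ = ∀' (rIn (# 0) (# 1) ↔ ψ)

Multipede₄ : Sentence
Multipede₄ = Multipede₃ ∧ In-sorted ∧ In-injective ∧ empty-represented ∧ insertion-represented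
  where
  In-sorted In-injective empty-represented insertion-represented : Sentence
  In-sorted = ∀' (∀' (rIn (# 1) (# 0) ⇒ segment (# 1) ∧ superSegment (# 0)))
  In-injective = ∀' (∀' (superSegment (# 1) ⇒ superSegment (# 0) ⇒
    membersSatisfy (rIn (# 0) (# 2)) ⇒ (# 1) ≐ (# 0)))
  empty-represented = ∃' (superSegment (# 0) ∧ ∀' (¬' (rIn (# 0) (# 1))))
  insertion-represented = ∀' (∀' (superSegment (# 1) ⇒ segment (# 0) ⇒
    ∃' (superSegment (# 0) ∧ membersSatisfy ((# 0) ≐ (# 2) ∨ rIn (# 0) (# 3)))))

oddlyManyIn : Formula 4
oddlyManyIn = rIn (# 2) (# 3) ⊕ rIn (# 1) (# 3) ⊕ rIn (# 0) (# 3)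

Oddness : Sentence
Oddness = ∀' (superSegment (# 0) ⇒ ∃' (rIn (# 0) (# 1)) ⇒
  ∃₃ (rT (# 2) (# 1) (# 0) ∧ segment (# 2) ∧ segment (# 1) ∧ segment (# 0) ∧ oddlyManyIn))

module _ (A : Structure) where
  open Structure A
  open Semantics A

  private
    U : Set
    U = Fin size

  ⟦_⟧₃ : ∀ {k} → Triple k → Vec U k → U × U × U
  ⟦ a , b , c ⟧₃ ρ = lookup ρ a , lookup ρ b , lookup ρ c

  FourPositiveSlaves : U → U → U → (s₁ s₂ s₃ s₄ : U × U × U) → Set
  FourPositiveSlaves x y z s₁ s₂ s₃ s₄ =
    (IsSlave A x y z s₁ × IsSlave A x y z s₂ × IsSlave A x y z s₃ × IsSlave A x y z s₄) ×
    (Positive A s₁ × Positive A s₂ × Positive A s₃ × Positive A s₄) ×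
    (s₁ ≢ s₂ × s₁ ≢ s₃ × s₁ ≢ s₄ × s₂ ≢ s₃ × s₂ ≢ s₄ × s₃ ≢ s₄) ×
    (SlaveEquiv A s₁ s₂ × SlaveEquiv A s₁ s₃ × SlaveEquiv A s₁ s₄ ×
     SlaveEquiv A s₂ s₃ × SlaveEquiv A s₂ s₄ × SlaveEquiv A s₃ s₄) ×
    (∀ s → IsSlave A x y z s → Positive A s → s ≡ s₁ ⊎ s ≡ s₂ ⊎ s ≡ s₃ ⊎ s ≡ s₄)

  private variable
    k : ℕ.ℕ
    ρ : Vec U k

  superSegment⇔ : ∀ {x} → Sat A (superSegment x) ρ ⇔ SuperSeg A (lookup ρ x)
  superSegment⇔ = mk⇔ (λ h → h ∘ from ∨⇔) (λ h → h ∘ to ∨⇔)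

  opaque
    unfolding _≐₃_

    ≐₃⇔ : ∀ {s s'} → Sat A (s ≐₃ s') ρ ⇔ ⟦ s ⟧₃ ρ ≡ ⟦ s' ⟧₃ ρ
    ≐₃⇔ = ≡×≡×≡⇔≡

  opaque
    unfolding slaveEquivᶠ

    slaveEquiv⇔ : ∀ {s s'} → Sat A (slaveEquivᶠ s s') ρ ⇔ SlaveEquiv A (⟦ s ⟧₃ ρ) (⟦ s' ⟧₃ ρ)
    slaveEquiv⇔ = ⇔-trans ∨⇔ (≐₃⇔ ⊎-⇔ ⇔-trans ∨⇔ (⇔-refl ⊎-⇔ ∨⇔))

  oneOf₄⇔ : ∀ {s s₁ s₂ s₃ s₄} →
    Sat A (s ≐₃ s₁ ∨ s ≐₃ s₂ ∨ s ≐₃ s₃ ∨ s ≐₃ s₄) ρ ⇔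
    (⟦ s ⟧₃ ρ ≡ ⟦ s₁ ⟧₃ ρ ⊎ ⟦ s ⟧₃ ρ ≡ ⟦ s₂ ⟧₃ ρ ⊎ ⟦ s ⟧₃ ρ ≡ ⟦ s₃ ⟧₃ ρ ⊎ ⟦ s ⟧₃ ρ ≡ ⟦ s₄ ⟧₃ ρ)
  oneOf₄⇔ = ⇔-trans ∨⇔ (≐₃⇔ ⊎-⇔ ⇔-trans ∨⇔ (≐₃⇔ ⊎-⇔ ⇔-trans ∨⇔ (≐₃⇔ ⊎-⇔ ≐₃⇔)))

  ≢⇔ : ∀ {s s'} → Sat A (¬' (s ≐₃ s')) ρ ⇔ ⟦ s ⟧₃ ρ ≢ ⟦ s' ⟧₃ ρ
  ≢⇔ = mk⇔ (_∘ from ≐₃⇔) (_∘ to ≐₃⇔)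

  fourPositiveSlaves⇔ : ∀ {x y z s₁ s₂ s₃ s₄} →
    Sat A (fourPositiveSlavesᶠ x y z s₁ s₂ s₃ s₄) ρ ⇔
    FourPositiveSlaves (lookup ρ x) (lookup ρ y) (lookup ρ z)
      (⟦ s₁ ⟧₃ ρ) (⟦ s₂ ⟧₃ ρ) (⟦ s₃ ⟧₃ ρ) (⟦ s₄ ⟧₃ ρ)
  fourPositiveSlaves⇔ = mk⇔
    (λ (slaves , positive , (d₁₂ , d₁₃ , d₁₄ , d₂₃ , d₂₄ , d₃₄) ,
        (e₁₂ , e₁₃ , e₁₄ , e₂₃ , e₂₄ , e₃₄) , onlyThese) →
      slaves , positive ,
      (to ≢⇔ d₁₂ , to ≢⇔ d₁₃ , to ≢⇔ d₁₄ , to ≢⇔ d₂₃ , to ≢⇔ d₂₄ , to ≢⇔ d₃₄) ,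
      (to slaveEquiv⇔ e₁₂ , to slaveEquiv⇔ e₁₃ , to slaveEquiv⇔ e₁₄ ,
       to slaveEquiv⇔ e₂₃ , to slaveEquiv⇔ e₂₄ , to slaveEquiv⇔ e₃₄) ,
      λ (a , b , c) slave pos → to oneOf₄⇔ (onlyThese $∀ a $∀ b $∀ c $⇒ slave $⇒ pos))
    (λ (slaves , positive , (d₁₂ , d₁₃ , d₁₄ , d₂₃ , d₂₄ , d₃₄) ,
        (e₁₂ , e₁₃ , e₁₄ , e₂₃ , e₂₄ , e₃₄) , onlyThese) →
      slaves , positive ,
      (from ≢⇔ d₁₂ , from ≢⇔ d₁₃ , from ≢⇔ d₁₄ , from ≢⇔ d₂₃ , from ≢⇔ d₂₄ , from ≢⇔ d₃₄) ,
      (from slaveEquiv⇔ e₁₂ , from slaveEquiv⇔ e₁₃ , from slaveEquiv⇔ e₁₄ ,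
       from slaveEquiv⇔ e₂₃ , from slaveEquiv⇔ e₂₄ , from slaveEquiv⇔ e₃₄) ,
      ∀-intro λ a → ∀-intro λ b → ∀-intro λ c → ⇒-intro λ slave → ⇒-intro λ pos →
        from oneOf₄⇔ (onlyThese (a , b , c) slave pos))

  HasFourPositiveSlaves : U → U → U → Set
  HasFourPositiveSlaves x y z =
    Σ (U × U × U) λ s₁ → Σ (U × U × U) λ s₂ → Σ (U × U × U) λ s₃ → Σ (U × U × U) λ s₄ →
      FourPositiveSlaves x y z s₁ s₂ s₃ s₄

  hasFourPositiveSlaves⇔ : ∀ x y z →
    Sat A hasFourPositiveSlaves (z ∷ y ∷ x ∷ []) ⇔ HasFourPositiveSlaves x y z
  hasFourPositiveSlaves⇔ x y z = mk⇔
    (λ (a₁ , b₁ , c₁ , a₂ , b₂ , c₂ , a₃ , b₃ , c₃ , a₄ , b₄ , c₄ , h) →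
      (a₁ , b₁ , c₁) , (a₂ , b₂ , c₂) , (a₃ , b₃ , c₃) , (a₄ , b₄ , c₄) , to fourPositiveSlaves⇔ h)
    (λ ((a₁ , b₁ , c₁) , (a₂ , b₂ , c₂) , (a₃ , b₃ , c₃) , (a₄ , b₄ , c₄) , h) →
      a₁ , b₁ , c₁ , a₂ , b₂ , c₂ , a₃ , b₃ , c₃ , a₄ , b₄ , c₄ , from fourPositiveSlaves⇔ h)

  ⊨Multipede₂⇔ : A ⊨ Multipede₂ ⇔ Is2Multipede A
  ⊨Multipede₂⇔ = mk⇔ axioms→ →axioms
    where
    axioms→ : A ⊨ Multipede₂ → Is2Multipede A
    axioms→ (ax₁ , ax₂ , ax₃ , ax₄ , ax₅ , ax₆ , ax₇ , ax₈ , ax₉) = record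
      { feet-not-segments = ax₁ $∀_
      ; foot-one-edge = λ a y y' e e' → ax₂ $∀ a $∀ y $∀ y' $⇒ (e , e')
      ; segment-two-feet = λ y sy →
          let a , b , a≢b , ea , eb , onlyThese = ax₃ $∀ y $⇒ sy
          in a , b , a≢b , ea , eb , λ c ec → to ∨⇔ (onlyThese $∀ c $⇒ ec)
      ; T-distinct = λ x y z t → ax₄ $∀ x $∀ y $∀ z $⇒ t
      ; T-sym₁ = λ x y z t → ax₅ $∀ x $∀ y $∀ z $⇒ t
      ; T-sym₂ = λ x y z t → ax₆ $∀ x $∀ y $∀ z $⇒ t
      ; T-sorted = λ x y z t → to ∨⇔ (ax₇ $∀ x $∀ y $∀ z $⇒ t)
      ; T-shadow = λ a b c x y z t fa fb fc ea eb ec →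
          ax₈ $∀ a $∀ b $∀ c $∀ x $∀ y $∀ z $⇒ t $⇒ fa $⇒ fb $⇒ fc $⇒ ea $⇒ eb $⇒ ec
      ; T-slaves = λ x y z t sx sy sz →
          to (hasFourPositiveSlaves⇔ x y z) (ax₉ $∀ x $∀ y $∀ z $⇒ t $⇒ sx $⇒ sy $⇒ sz)
      }

    →axioms : Is2Multipede A → A ⊨ Multipede₂
    →axioms m =
      ∀-intro feet-not-segments ,
      (∀₃-intro λ a y y' → ⇒-intro λ (e , e') → foot-one-edge a y y' e e') ,
      (∀-intro λ y → ⇒-intro λ sy →
        let a , b , a≢b , ea , eb , onlyThese = segment-two-feet y sy
        in a , b , a≢b , ea , eb , ∀-intro λ c → ⇒-intro λ ec → from ∨⇔ (onlyThese c ec)) ,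
      (∀₃-intro λ x y z → ⇒-intro (T-distinct x y z)) ,
      (∀₃-intro λ x y z → ⇒-intro (T-sym₁ x y z)) ,
      (∀₃-intro λ x y z → ⇒-intro (T-sym₂ x y z)) ,
      (∀₃-intro λ x y z → ⇒-intro (from ∨⇔ ∘ T-sorted x y z)) ,
      (∀₃-intro λ a b c → ∀₃-intro λ x y z →
        ⇒-intro λ t → ⇒-intro λ fa → ⇒-intro λ fb → ⇒-intro λ fc →
        ⇒-intro λ ea → ⇒-intro λ eb → ⇒-intro λ ec → T-shadow a b c x y z t fa fb fc ea eb ec) ,
      (∀₃-intro λ x y z → ⇒-intro λ t → ⇒-intro λ sx → ⇒-intro λ sy → ⇒-intro λ sz →
        from (hasFourPositiveSlaves⇔ x y z) (T-slaves x y z t sx sy sz))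
      where open Is2Multipede m

  ⊨Multipede₃⇔ : A ⊨ Multipede₃ ⇔ Is3Multipede A
  ⊨Multipede₃⇔ = mk⇔ axioms→ →axioms
    where
    axioms→ : A ⊨ Multipede₃ → Is3Multipede A
    axioms→ (m₂ , ax₁ , ax₂ , ax₃ , ax₄) = record
      { is2 = to ⊨Multipede₂⇔ m₂
      ; Lt-segments = λ x y l → ax₁ $∀ x $∀ y $⇒ l
      ; Lt-irrefl = ax₂ $∀_
      ; Lt-trans = λ x y z l l' → ax₃ $∀ x $∀ y $∀ z $⇒ l $⇒ l'
      ; Lt-total = λ x y sx sy → Sum.map₂ (to ∨⇔) (to ∨⇔ (ax₄ $∀ x $∀ y $⇒ sx $⇒ sy))
      }

    →axioms : Is3Multipede A → A ⊨ Multipede₃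
    →axioms m =
      from ⊨Multipede₂⇔ is2 ,
      (∀-intro λ x → ∀-intro λ y → ⇒-intro (Lt-segments x y)) ,
      ∀-intro Lt-irrefl ,
      (∀₃-intro λ x y z → ⇒-intro λ l → ⇒-intro (Lt-trans x y z l)) ,
      (∀-intro λ x → ∀-intro λ y → ⇒-intro λ sx → ⇒-intro λ sy →
        from ∨⇔ (Sum.map₂ (from ∨⇔) (Lt-total x y sx sy)))
      where open Is3Multipede m

  Represents : U → (U → Set) → Set
  Represents σ P = SuperSeg A σ × (∀ x → In x σ ≡ true ⇔ P x)

  membersSatisfy⇔ : ∀ {ψ σ} →
    Sat A (membersSatisfy ψ) (σ ∷ ρ) ⇔ (∀ x → In x σ ≡ true ⇔ Sat A ψ (x ∷ σ ∷ ρ))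
  membersSatisfy⇔ = mk⇔ (λ h x → to ↔⇔ (h $∀ x)) (λ h → ∀-intro λ x → from ↔⇔ (h x))

  module _ (empty : Σ U λ σ → SuperSeg A σ × (∀ x → In x σ ≢ true))
           (insert : ∀ σ y → SuperSeg A σ → Seg A y →
             Σ U λ τ → Represents τ (λ x → x ≡ y ⊎ In x σ ≡ true)) where

    representsList : (L : List U) → (∀ x → x ∈ₗ L → Seg A x) → Σ U λ σ → Represents σ (_∈ₗ L)
    representsList [] _ =
      let σ , sσ , none = empty in σ , sσ , λ x → mk⇔ (⊥-elim ∘ none x) λ ()
    representsList (y ∷ L) segs =
      let σ , sσ , σ≈L = representsList L (λ x → segs x ∘ there)
          τ , sτ , τ≈y∷σ = insert σ y sσ (segs y (here refl))
      in τ , sτ , λ x → ⇔-trans (τ≈y∷σ x) (⇔-trans (⇔-refl ⊎-⇔ σ≈L x) (↔⇒⇔ (∷↔ (x ≡_))))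

    representsSubset : ∀ X → (∀ x → x ∈ X → Seg A x) → Σ U λ σ → Represents σ (_∈ X)
    representsSubset X segs =
      let σ , sσ , σ≈L = representsList L (λ x → segs x ∘ proj₂ ∘ ∈L⁻)
      in σ , sσ , λ x → ⇔-trans (σ≈L x) (mk⇔ (proj₂ ∘ ∈L⁻) (∈-filter⁺ (_∈? X) (∈-allFin x)))
      where
      L : List U
      L = filter (_∈? X) (allFin size)
      ∈L⁻ : ∀ {x} → x ∈ₗ L → x ∈ₗ allFin size × x ∈ X
      ∈L⁻ = ∈-filter⁻ (_∈? X)

  members : U → Subset size
  members σ = tabulate λ x → In x σ

  ∈-members : ∀ {x σ} → x ∈ members σ ⇔ In x σ ≡ true
  ∈-members {x} {σ} = mk⇔ (λ m → trans (sym (lookup∘tabulate (_∈σ) x)) ([]=⇒lookup m))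
                          (λ e → lookup⇒[]= x _ (trans (lookup∘tabulate (_∈σ) x) e))
    where
    _∈σ : U → Bool
    y ∈σ = In y σ

  ∈⁅y⁆∪members⇔ : ∀ {x y σ} → x ∈ ⁅ y ⁆ ∪ members σ ⇔ (x ≡ y ⊎ In x σ ≡ true)
  ∈⁅y⁆∪members⇔ = ⇔-trans ∪⇔⊎ (x∈⁅y⁆⇔x≡y ⊎-⇔ ∈-members)

  ⊨Multipede₄⇔ : A ⊨ Multipede₄ ⇔ Is4Multipede A
  ⊨Multipede₄⇔ = mk⇔ axioms→ →axioms
    where
    axioms→ : A ⊨ Multipede₄ → Is4Multipede A
    axioms→ (m₃ , sorted , injective , empty , insertion) = record
      { is3 = to ⊨Multipede₃⇔ m₃
      ; In-sorted = λ x σ i → map₂ (to superSegment⇔) (sorted $∀ x $∀ σ $⇒ i)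
      ; In-injective = λ σ τ sσ sτ same →
          injective $∀ σ $∀ τ $⇒ from superSegment⇔ sσ $⇒ from superSegment⇔ sτ
            $⇒ from membersSatisfy⇔ (λ x → ⇔-sym (same x))
      ; In-surjective = representsSubset
          (let σ , sσ , none = empty in σ , to superSegment⇔ sσ , (none $∀_))
          (λ σ y sσ sy →
            let τ , sτ , τ≈y∷σ = insertion $∀ σ $∀ y $⇒ from superSegment⇔ sσ $⇒ sy
            in τ , to superSegment⇔ sτ , λ x → ⇔-trans (to membersSatisfy⇔ τ≈y∷σ x) ∨⇔)
      }

    →axioms : Is4Multipede A → A ⊨ Multipede₄
    →axioms m =
      from ⊨Multipede₃⇔ is3 ,
      (∀-intro λ x → ∀-intro λ σ → ⇒-intro λ i → map₂ (from superSegment⇔) (In-sorted x σ i)) ,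
      (∀-intro λ σ → ∀-intro λ τ → ⇒-intro λ sσ → ⇒-intro λ sτ → ⇒-intro λ same →
        In-injective σ τ (to superSegment⇔ sσ) (to superSegment⇔ sτ)
          (λ x → ⇔-sym (to membersSatisfy⇔ same x))) ,
      (let σ , sσ , σ≈∅ = In-surjective ∅ (λ _ → ⊥-elim ∘ ∉⊥)
       in σ , from superSegment⇔ sσ , ∀-intro λ x → ∉⊥ ∘ to (σ≈∅ x)) ,
      (∀-intro λ σ → ∀-intro λ y → ⇒-intro λ _ → ⇒-intro λ sy →
        let τ , sτ , τ≈y∷σ = In-surjective (⁅ y ⁆ ∪ members σ)
              (λ x → Sum.[ (λ { refl → sy }) , proj₁ ∘ In-sorted x σ ] ∘ to ∈⁅y⁆∪members⇔)
        in τ , from superSegment⇔ sτ ,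
           from membersSatisfy⇔ λ x → ⇔-trans (τ≈y∷σ x) (⇔-trans ∈⁅y⁆∪members⇔ (⇔-sym ∨⇔)))
      where open Is4Multipede m

  oddlyManyIn⇔xor : ∀ x y z σ →
    Sat A oddlyManyIn (z ∷ y ∷ x ∷ σ ∷ []) ⇔ (In x σ xor In y σ xor In z σ) ≡ true
  oddlyManyIn⇔xor x y z σ =
    subst (λ b → Sat A oddlyManyIn env ⇔ b ≡ true) truth≡xor (sat⇔truth oddlyManyIn)
    where
    env : Vec U 4
    env = z ∷ y ∷ x ∷ σ ∷ []
    truth≡xor : truth oddlyManyIn env ≡ In x σ xor In y σ xor In z σ
    truth≡xor = begin
      truth oddlyManyIn env
        ≡⟨ truth-⊕ (rIn (# 2) (# 3)) (rIn (# 1) (# 3) ⊕ rIn (# 0) (# 3)) ⟩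
      In x σ xor truth (rIn (# 1) (# 3) ⊕ rIn (# 0) (# 3)) env
        ≡⟨ cong (In x σ xor_) (truth-⊕ (rIn (# 1) (# 3)) (rIn (# 0) (# 3))) ⟩
      In x σ xor In y σ xor In z σ ∎
      where open ≡-Reasoning

  count∈-odd⇔xor : ∀ X x y z →
    count∈ A X x y z % 2 ≡ 1 ⇔ (does (x ∈? X) xor does (y ∈? X) xor does (z ∈? X)) ≡ true
  -- count∈ counts with a private b2n, hence the case analysis on the three memberships.
  count∈-odd⇔xor X x y z with does (x ∈? X) | does (y ∈? X) | does (z ∈? X)
  ... | true  | true  | true  = mk⇔ (λ _ → refl) (λ _ → refl)
  ... | true  | true  | false = mk⇔ (λ ()) (λ ())
  ... | true  | false | true  = mk⇔ (λ ()) (λ ())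
  ... | true  | false | false = mk⇔ (λ _ → refl) (λ _ → refl)
  ... | false | true  | true  = mk⇔ (λ ()) (λ ())
  ... | false | true  | false = mk⇔ (λ _ → refl) (λ _ → refl)
  ... | false | false | true  = mk⇔ (λ _ → refl) (λ _ → refl)
  ... | false | false | false = mk⇔ (λ ()) (λ ())

  oddlyManyIn⇔count∈-odd : ∀ {σ X} → (∀ x → In x σ ≡ true ⇔ x ∈ X) → ∀ x y z →
    Sat A oddlyManyIn (z ∷ y ∷ x ∷ σ ∷ []) ⇔ count∈ A X x y z % 2 ≡ 1
  oddlyManyIn⇔count∈-odd {σ} {X} σ≈X x y z =
    ⇔-trans (oddlyManyIn⇔xor x y z σ)
      (subst (λ b → b ≡ true ⇔ _) xors≡ (⇔-sym (count∈-odd⇔xor X x y z)))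
    where
    does∈≡In : ∀ w → does (w ∈? X) ≡ In w σ
    does∈≡In w = does-⇔ (⇔-sym (σ≈X w)) (w ∈? X) (isTrue? (In w σ))
    xors≡ : does (x ∈? X) xor does (y ∈? X) xor does (z ∈? X) ≡ In x σ xor In y σ xor In z σ
    xors≡ = cong₂ _xor_ (does∈≡In x) (cong₂ _xor_ (does∈≡In y) (does∈≡In z))

  ⊨Oddness⇔ : Is4Multipede A → A ⊨ Oddness ⇔ IsOdd A
  ⊨Oddness⇔ m = mk⇔ axiom→ →axiom
    where
    open Is4Multipede m

    axiom→ : A ⊨ Oddness → IsOdd A
    axiom→ odd X segs (x₀ , x₀∈X) =
      let σ , sσ , σ≈X = In-surjective X segs
          x , y , z , t , sx , sy , sz , oddly =
            odd $∀ σ $⇒ from superSegment⇔ sσ $⇒ (x₀ , from (σ≈X x₀) x₀∈X)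
      in x , y , z , t , sx , sy , sz , to (oddlyManyIn⇔count∈-odd σ≈X x y z) oddly

    →axiom : IsOdd A → A ⊨ Oddness
    →axiom odd = ∀-intro λ σ → ⇒-intro λ _ → ⇒-intro λ (x₀ , x₀∈σ) →
      let x , y , z , t , sx , sy , sz , oddly =
            odd (members σ) (λ x → proj₁ ∘ In-sorted x σ ∘ to ∈-members) (x₀ , from ∈-members x₀∈σ)
      in x , y , z , t , sx , sy , sz ,
         from (oddlyManyIn⇔count∈-odd (λ _ → ⇔-sym ∈-members) x y z) oddly

lemma4p3 : FinitelyAxiomatizable IsOdd4Multipede
lemma4p3 = (Multipede₄ ∧ Oddness) , λ A → mk⇔
  (λ (m , odd) → let m₄ = to (⊨Multipede₄⇔ A) m in m₄ , to (⊨Oddness⇔ A m₄) odd)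
  (λ (m₄ , odd) → from (⊨Multipede₄⇔ A) m₄ , from (⊨Oddness⇔ A m₄) odd)
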